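{- Let $X$ be a finite set, $m:X\to\{\mathrm{odd},\mathrm{even}\}$ a map, and $(N_1,N_2,N_3)$ a moderately balanced occupancy requirement for $X$ and $m$. Then there exists an occupancy assignment for $(N_1,N_2,N_3)$.
   Context: A triple $(N_1,N_2,N_3)$ of non-negative integers is a moderately balanced occupancy requirement (for $X$ and $m$) if (a) $N_1+N_2+N_3=7|X|$; (b) $3|X|\le N_2\le4|X|$ and $N_1,N_3\ge|X|$; (c) $N_2$ has the same parity as $|m^{ -1}(\mathrm{odd})|$. An occupancy assignment for $(N_1,N_2,N_3)$ is a map $\aleph:X\to\mathbb{Z}^3$ such that for every $x\in X$: $\aleph(x)_1\ge1$, $\aleph(x)_3\ge1$, $\aleph(x)_2\ge2$; $\aleph(x)_1+\aleph(x)_2+\aleph(x)_3=7$; $\aleph(x)_2$ is odd if and only if $m(x)=\mathrm{odd}$; and for each $i\in\{1,2,3\}$, $\sum_{x\in X}\aleph(x)_i=N_i$. -}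

module Defs where

open import Data.Nat as ℕ using (ℕ; zero; suc)
open import Data.Integer as ℤ using (ℤ; +_)
open import Data.Fin using (Fin; zero; suc)
open import Data.Product using (_×_; _,_; proj₁; proj₂)
open import Data.Bool using (Bool; true; false; if_then_else_)
open import Relation.Binary.PropositionalEquality using (_≡_)
open import Function.Bundles using (_⇔_)

data OddEven : Set where
  odd even : OddEven

isOdd : OddEven → Bool
isOdd odd  = true
isOdd even = false

natParity : ℕ → OddEven
natParity zero = even
natParity (suc zero) = odd
natParity (suc (suc n)) = natParity n

intParity : ℤ → OddEven
intParity z = natParity ℤ.∣ z ∣

sumℤ : (n : ℕ) → (Fin n → ℤ) → ℤ
sumℤ zero    f = + 0
sumℤ (suc n) f = f zero ℤ.+ sumℤ n (λ i → f (suc i))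

countOdd : (n : ℕ) → (Fin n → OddEven) → ℕ
countOdd zero    m = 0
countOdd (suc n) m = (if isOdd (m zero) then 1 else 0) ℕ.+ countOdd n (λ i → m (suc i))

ℤ³ : Set
ℤ³ = ℤ × ℤ × ℤ

c₁ c₂ c₃ : ℤ³ → ℤ
c₁ v = proj₁ v
c₂ v = proj₁ (proj₂ v)
c₃ v = proj₂ (proj₂ v)

record ModeratelyBalanced (n : ℕ) (m : Fin n → OddEven) (N₁ N₂ N₃ : ℕ) : Set where
  field
    total  : N₁ ℕ.+ N₂ ℕ.+ N₃ ≡ 7 ℕ.* n
    N₂-low : 3 ℕ.* n ℕ.≤ N₂
    N₂-up  : N₂ ℕ.≤ 4 ℕ.* n
    N₁-low : n ℕ.≤ N₁
    N₃-low : n ℕ.≤ N₃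
    parity : natParity N₂ ≡ natParity (countOdd n m)

record IsOccupancyAssignment (n : ℕ) (m : Fin n → OddEven) (N₁ N₂ N₃ : ℕ)
                             (ℵ : Fin n → ℤ³) : Set where
  field
    pos₁   : ∀ x → + 1 ℤ.≤ c₁ (ℵ x)
    pos₃   : ∀ x → + 1 ℤ.≤ c₃ (ℵ x)
    pos₂   : ∀ x → + 2 ℤ.≤ c₂ (ℵ x)
    sum7   : ∀ x → c₁ (ℵ x) ℤ.+ c₂ (ℵ x) ℤ.+ c₃ (ℵ x) ≡ + 7
    parity : ∀ x → (intParity (c₂ (ℵ x)) ≡ odd) ⇔ (m x ≡ odd)
    sum₁   : sumℤ n (λ x → c₁ (ℵ x)) ≡ + N₁
    sum₂   : sumℤ n (λ x → c₂ (ℵ x)) ≡ + N₂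
    sum₃   : sumℤ n (λ x → c₃ (ℵ x)) ≡ + N₃

-- Subtracting the minimal occupancy (1, 2, 1) from every x leaves residual
-- triples summing to 3 whose middle entry has the parity of m x, with column
-- totals P = N₁ − n, U = N₂ − 2n, Q = N₃ − n.  The middle column is built first:
-- start from 1 at odd points and 0 at even ones (total |m⁻¹(odd)|) and raise
-- (U − |m⁻¹(odd)|)/2 of the entries by 2, which the parity and the bound
-- N₂ ≤ 4n permit.  The complements 3 − b(x) then add up to P + Q, and any such
-- total splits pointwise into two columns with totals P and Q, by the Riesz
-- refinement property of ℕ.
module Submission where

open import Defs
open import Data.Nat using (ℕ)
open import Data.Fin using (Fin)
open import Data.Product using (Σ)

open import Data.Nat using (zero; suc; _+_; _*_; _∸_; _≤_; z≤n; s≤s)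
open import Data.Nat.Properties
open import Data.Nat.Tactic.RingSolver using (solve-∀)
open import Data.Integer as ℤ using (+≤+)
open import Data.Fin using (zero; suc)
open import Data.Vec.Functional using (_∷_)
open import Data.Product using (_×_; _,_; ∃-syntax; ∃₂)
open import Data.Bool using (if_then_else_)
open import Function using (_∘_)
open import Function.Bundles using (mk⇔)
open import Relation.Binary.PropositionalEquality
open ≡-Reasoning
open import Algebra.Properties.Semiring.Sum +-*-semiring
  using (sum; sum-cong-≗; ∑-distrib-+; *-distribˡ-sum)

sum-const : ∀ n k → sum {n} (λ _ → k) ≡ k * n
sum-const zero    k = sym (*-zeroʳ k)
sum-const (suc n) k = trans (cong (k +_) (sum-const n k)) (sym (*-suc k n))

sum-shift : ∀ {n} k (f : Fin n → ℕ) → sum (λ x → k + f x) ≡ k * n + sum f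
sum-shift {n} k f = trans (∑-distrib-+ (λ _ → k) f) (cong (_+ sum f) (sum-const n k))

sumℤ-+ : ∀ n (f : Fin n → ℕ) → sumℤ n (λ x → ℤ.+ f x) ≡ ℤ.+ sum f
sumℤ-+ zero    f = refl
sumℤ-+ (suc n) f = cong (ℤ._+_ (ℤ.+ f zero)) (sumℤ-+ n (f ∘ suc))

+-refine : ∀ a b c d → a + b ≡ c + d →
  ∃[ p ] ∃[ q ] ∃[ r ] ∃[ s ] (a ≡ p + q × b ≡ r + s × c ≡ p + r × d ≡ q + s)
+-refine zero    b c       d eq = 0 , 0 , c , d , refl , eq , refl , refl
+-refine (suc a) b zero    d eq = 0 , suc a , 0 , b , refl , refl , refl , sym eq
+-refine (suc a) b (suc c) d eq with +-refine a b c d (suc-injective eq)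
... | p , q , r , s , a≡ , b≡ , c≡ , d≡ = suc p , q , r , s , cong suc a≡ , b≡ , cong suc c≡ , d≡

sum-split : ∀ n (r : Fin n → ℕ) T S → T + S ≡ sum r →
  ∃₂ λ (a c : Fin n → ℕ) → (∀ x → a x + c x ≡ r x) × sum a ≡ T × sum c ≡ S
sum-split zero r T S eq =
  (λ ()) , (λ ()) , (λ ()) , sym (m+n≡0⇒m≡0 T eq) , sym (m+n≡0⇒n≡0 T eq)
sum-split (suc n) r T S eq with +-refine T S (r zero) (sum (r ∘ suc)) eq
... | p , q , u , v , refl , refl , r₀≡ , rest≡ with sum-split n (r ∘ suc) q v (sym rest≡)
... | a , c , a+c≡r , refl , refl =
  p ∷ a , u ∷ c , (λ { zero → sym r₀≡ ; (suc x) → a+c≡r x }) , refl , refl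

natParity-2*+ : ∀ k a → natParity (2 * k + a) ≡ natParity a
natParity-2*+ zero    a = refl
natParity-2*+ (suc k) a = trans (cong (λ s → natParity (s + a)) (*-suc 2 k)) (natParity-2*+ k a)

natParity-+2* : ∀ a k → natParity (a + 2 * k) ≡ natParity a
natParity-+2* a k = trans (cong natParity (+-comm a (2 * k))) (natParity-2*+ k a)

≤-natParity⇒+2* : ∀ {a b} → a ≤ b → natParity a ≡ natParity b → ∃[ j ] b ≡ a + 2 * j
≤-natParity⇒+2* {zero}        {zero}                _            _  = 0 , refl
≤-natParity⇒+2* {zero}        {suc zero}            _            ()
≤-natParity⇒+2* {zero}        {suc (suc b)}         _            eq
  with ≤-natParity⇒+2* {zero} {b} z≤n eq
... | j , refl = suc j , sym (*-suc 2 j)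
≤-natParity⇒+2* {suc zero}    {suc zero}            _            _  = 0 , refl
≤-natParity⇒+2* {suc zero}    {suc (suc zero)}      _            ()
≤-natParity⇒+2* {suc zero}    {suc (suc (suc b))}   _            eq
  with ≤-natParity⇒+2* {1} {suc b} (s≤s z≤n) eq
... | j , refl = suc j , cong suc (sym (*-suc 2 j))
≤-natParity⇒+2* {suc (suc a)} {suc (suc b)} (s≤s (s≤s a≤b)) eq
  with ≤-natParity⇒+2* a≤b eq
... | j , refl = j , refl

oddBit evenBit : OddEven → ℕ
oddBit  o = if isOdd o then 1 else 0
evenBit o = if isOdd o then 0 else 1

oddBit+evenBit : ∀ o → oddBit o + evenBit o ≡ 1
oddBit+evenBit odd  = refl
oddBit+evenBit even = refl

natParity-oddBit : ∀ o → natParity (oddBit o) ≡ o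
natParity-oddBit odd  = refl
natParity-oddBit even = refl

countOdd≡sum : ∀ n (m : Fin n → OddEven) → countOdd n m ≡ sum (oddBit ∘ m)
countOdd≡sum zero    m = refl
countOdd≡sum (suc n) m = cong (oddBit (m zero) +_) (countOdd≡sum n (m ∘ suc))

countOdd≤n : ∀ n (m : Fin n → OddEven) → countOdd n m ≤ n
countOdd≤n zero    m = z≤n
countOdd≤n (suc n) m with m zero
... | odd  = s≤s (countOdd≤n n (m ∘ suc))
... | even = m≤n⇒m≤1+n (countOdd≤n n (m ∘ suc))

middleColumn : ∀ n (m : Fin n → OddEven) U →
  countOdd n m ≤ U → U ≤ countOdd n m + 2 * n → natParity U ≡ natParity (countOdd n m) →
  ∃₂ λ (b r : Fin n → ℕ) →
    (∀ x → b x + r x ≡ 3) × (∀ x → natParity (b x) ≡ m x) × sum b ≡ U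
middleColumn n m U lo hi par with ≤-natParity⇒+2* lo (sym par)
... | j , refl with sum-split n (λ _ → 1) j (n ∸ j) flags-total
  where
  j≤n : j ≤ n
  j≤n = *-cancelˡ-≤ 2 (+-cancelˡ-≤ (countOdd n m) _ _ hi)
  flags-total : j + (n ∸ j) ≡ sum {n} (λ _ → 1)
  flags-total = trans (m+[n∸m]≡n j≤n) (sym (trans (sum-const n 1) (*-identityˡ n)))
... | e , f , e+f≡1 , Σe≡j , _ = b , r , b+r≡3 , natParity-b , Σb≡U
  where
  b r : Fin n → ℕ
  b x = oddBit (m x) + 2 * e x
  r x = evenBit (m x) + 2 * f x
  regroup : ∀ o e o′ f → (o + 2 * e) + (o′ + 2 * f) ≡ (o + o′) + 2 * (e + f)
  regroup = solve-∀
  b+r≡3 : ∀ x → b x + r x ≡ 3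
  b+r≡3 x = begin
    b x + r x
      ≡⟨ regroup (oddBit (m x)) (e x) (evenBit (m x)) (f x) ⟩
    (oddBit (m x) + evenBit (m x)) + 2 * (e x + f x)
      ≡⟨ cong₂ (λ s t → s + 2 * t) (oddBit+evenBit (m x)) (e+f≡1 x) ⟩
    3 ∎
  natParity-b : ∀ x → natParity (b x) ≡ m x
  natParity-b x = trans (natParity-+2* (oddBit (m x)) (e x)) (natParity-oddBit (m x))
  Σb≡U : sum b ≡ countOdd n m + 2 * j
  Σb≡U = begin
    sum b                                  ≡⟨ ∑-distrib-+ (oddBit ∘ m) (λ x → 2 * e x) ⟩
    sum (oddBit ∘ m) + sum (λ x → 2 * e x) ≡⟨ cong₂ _+_ (sym (countOdd≡sum n m)) (sym (*-distribˡ-sum 2 e)) ⟩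
    countOdd n m + 2 * sum e               ≡⟨ cong (λ s → countOdd n m + 2 * s) Σe≡j ⟩
    countOdd n m + 2 * j                   ∎

shiftedAssignment : ∀ n (m : Fin n → OddEven) P U Q →
  P + U + Q ≡ 3 * n → countOdd n m ≤ U → U ≤ countOdd n m + 2 * n →
  natParity U ≡ natParity (countOdd n m) →
  Σ (Fin n → ℤ³) (IsOccupancyAssignment n m (n + P) (2 * n + U) (n + Q))
shiftedAssignment n m P U Q total lo hi par with middleColumn n m U lo hi par
... | b , r , b+r≡3 , natParity-b , Σb≡U with sum-split n r P Q P+Q≡Σr
  where
  P+Q≡Σr : P + Q ≡ sum r
  P+Q≡Σr = +-cancelʳ-≡ U _ _ (begin
    P + Q + U                 ≡⟨ +-assoc P Q U ⟩
    P + (Q + U)               ≡⟨ cong (P +_) (+-comm Q U) ⟩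
    P + (U + Q)               ≡⟨ sym (+-assoc P U Q) ⟩
    P + U + Q                 ≡⟨ total ⟩
    3 * n                     ≡⟨ sym (sum-const n 3) ⟩
    sum {n} (λ _ → 3)         ≡⟨ sum-cong-≗ (sym ∘ b+r≡3) ⟩
    sum (λ x → b x + r x)     ≡⟨ ∑-distrib-+ b r ⟩
    sum b + sum r             ≡⟨ cong (_+ sum r) Σb≡U ⟩
    U + sum r                 ≡⟨ +-comm U (sum r) ⟩
    sum r + U                 ∎)
... | a , c , a+c≡r , Σa≡P , Σc≡Q = ℵ , record
  { pos₁   = λ _ → +≤+ (s≤s z≤n)
  ; pos₃   = λ _ → +≤+ (s≤s z≤n)
  ; pos₂   = λ _ → +≤+ (s≤s (s≤s z≤n))
  ; sum7   = λ x → cong ℤ.+_ (row-sum x)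
  ; parity = λ x → mk⇔ (trans (sym (natParity-b x))) (trans (natParity-b x))
  ; sum₁   = column 1 a (cong₂ _+_ (*-identityˡ n) Σa≡P)
  ; sum₂   = column 2 b (cong (2 * n +_) Σb≡U)
  ; sum₃   = column 1 c (cong₂ _+_ (*-identityˡ n) Σc≡Q)
  }
  where
  ℵ : Fin n → ℤ³
  ℵ x = ℤ.+ (1 + a x) , ℤ.+ (2 + b x) , ℤ.+ (1 + c x)
  regroup : ∀ a b c → (1 + a) + (2 + b) + (1 + c) ≡ 4 + (b + (a + c))
  regroup = solve-∀
  row-sum : ∀ x → (1 + a x) + (2 + b x) + (1 + c x) ≡ 7
  row-sum x = begin
    (1 + a x) + (2 + b x) + (1 + c x) ≡⟨ regroup (a x) (b x) (c x) ⟩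
    4 + (b x + (a x + c x))           ≡⟨ cong (λ s → 4 + (b x + s)) (a+c≡r x) ⟩
    4 + (b x + r x)                   ≡⟨ cong (4 +_) (b+r≡3 x) ⟩
    7                                 ∎
  column : ∀ k (f : Fin n → ℕ) {N} → k * n + sum f ≡ N → sumℤ n (λ x → ℤ.+ (k + f x)) ≡ ℤ.+ N
  column k f eq = trans (sumℤ-+ n (λ x → k + f x)) (cong ℤ.+_ (trans (sum-shift k f) eq))

lemma12p2 : (n : ℕ) (m : Fin n → OddEven) (N₁ N₂ N₃ : ℕ) →
    ModeratelyBalanced n m N₁ N₂ N₃ →
    Σ (Fin n → ℤ³) (λ ℵ → IsOccupancyAssignment n m N₁ N₂ N₃ ℵ)
lemma12p2 n m N₁ N₂ N₃ mb
  with m≤n⇒∃[o]m+o≡n (N₁-low mb)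
     | m≤n⇒∃[o]m+o≡n (≤-trans (*-monoˡ-≤ n (n≤1+n 2)) (N₂-low mb))
     | m≤n⇒∃[o]m+o≡n (N₃-low mb)
  where open ModeratelyBalanced
... | P , refl | U , refl | Q , refl =
  shiftedAssignment n m P U Q residual-total
    (≤-trans (countOdd≤n n m) n≤U) (≤-trans U≤2n (m≤n+m (2 * n) (countOdd n m)))
    (trans (sym (natParity-2*+ n U)) parity)
  where
  open ModeratelyBalanced mb
  regroup : ∀ n P U Q → n + P + (2 * n + U) + (n + Q) ≡ 4 * n + (P + U + Q)
  regroup = solve-∀
  residual-total : P + U + Q ≡ 3 * n
  residual-total = +-cancelˡ-≡ (4 * n) _ _
    (trans (sym (regroup n P U Q)) (trans total (*-distribʳ-+ n 4 3)))
  n≤U : n ≤ U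
  n≤U = +-cancelˡ-≤ (2 * n) n U (subst (_≤ 2 * n + U) (+-comm n (2 * n)) N₂-low)
  U≤2n : U ≤ 2 * n
  U≤2n = +-cancelˡ-≤ (2 * n) U (2 * n) (subst (2 * n + U ≤_) (*-distribʳ-+ n 2 2) N₂-up)
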